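{- Let $n$ be a positive integer, $k$ a non-negative integer, and $\mathrm{TH}_m=\binom{m+2}{3}$. Then: (1) if $n=6k$, $\gcd\{\mathrm{TH}_n,\mathrm{TH}_{n+1}\}=(6k+1)(3k+1)$; (2) if $n=6k+1$, $\gcd\{\mathrm{TH}_n,\mathrm{TH}_{n+1}\}=(3k+1)(2k+1)$; (3) if $n=6k+2$, $\gcd\{\mathrm{TH}_n,\mathrm{TH}_{n+1}\}=(2k+1)(3k+2)$; (4) if $n=6k+3$, $\gcd\{\mathrm{TH}_n,\mathrm{TH}_{n+1}\}=(3k+2)(6k+5)$; (5) if $n=6k+4$, $\gcd\{\mathrm{TH}_n,\mathrm{TH}_{n+1}\}=(6k+5)(k+1)$; (6) if $n=6k+5$, $\gcd\{\mathrm{TH}_n,\mathrm{TH}_{n+1}\}=(k+1)(6k+7)$. -}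

module Defs where

open import Data.Nat using (ℕ; _+_)
open import Data.Nat.Combinatorics using (_C_)

TH : ℕ → ℕ
TH m = (m + 2) C 3

-- Since 6 · TH m = m (m + 1) (m + 2), the numbers TH n and TH (n + 1) share the factor
-- (n + 1)(n + 2); in each residue class of n modulo 6 the factors 2 and 3 of the
-- denominator can be distributed so that TH n = a · b and TH (n + 1) = a · c with b and c
-- linear in k and linked by a Bézout identity u · b = v · c + 1 (or the symmetric one).
-- Then gcd (a · b) (a · c) = a · gcd b c = a.
module Submission where

open import Data.List using ([]; _∷_)
open import Data.Nat using (ℕ; zero; suc; _+_; _*_; _≤_)
open import Data.Nat.Combinatorics using (_C_; nC1≡n; nCk+nC[k+1]≡[n+1]C[k+1])
open import Data.Nat.Divisibility using (_∣_; ∣1⇒≡1; ∣m+n∣m⇒∣n; ∣n⇒∣m*n)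
open import Data.Nat.GCD using (gcd; module Bézout; gcd[m,n]∣m; gcd[m,n]∣n; gcd-comm; c*gcd[m,n]≡gcd[cm,cn])
open import Data.Nat.Properties using (*-distribˡ-+; *-assoc; *-identityʳ; *-cancelˡ-≡; +-comm)
open import Data.Nat.Tactic.RingSolver using (solve)
open import Data.Product using (_×_; _,_)
open import Relation.Binary.PropositionalEquality

open import Defs

open ≡-Reasoning

2*[1+n]C2≡n*[1+n] : ∀ n → 2 * (suc n C 2) ≡ n * suc n
2*[1+n]C2≡n*[1+n] zero    = refl
2*[1+n]C2≡n*[1+n] (suc n) = begin
  2 * (suc (suc n) C 2)                  ≡⟨ cong (2 *_) (nCk+nC[k+1]≡[n+1]C[k+1] (suc n) 1) ⟨
  2 * (suc n C 1 + suc n C 2)            ≡⟨ *-distribˡ-+ 2 (suc n C 1) (suc n C 2) ⟩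
  2 * (suc n C 1) + 2 * (suc n C 2)      ≡⟨ cong₂ (λ a b → 2 * a + b) (nC1≡n (suc n)) (2*[1+n]C2≡n*[1+n] n) ⟩
  2 * suc n + n * suc n                  ≡⟨ solve (n ∷ []) ⟩
  suc n * suc (suc n)                    ∎

6*[2+n]C3≡n*[1+n]*[2+n] : ∀ n → 6 * (suc (suc n) C 3) ≡ n * suc n * suc (suc n)
6*[2+n]C3≡n*[1+n]*[2+n] zero    = refl
6*[2+n]C3≡n*[1+n]*[2+n] (suc n) = begin
  6 * (3+n C 3)                          ≡⟨ cong (6 *_) (nCk+nC[k+1]≡[n+1]C[k+1] (2 + n) 2) ⟨
  6 * (2+n C 2 + 2+n C 3)                ≡⟨ *-distribˡ-+ 6 (2+n C 2) (2+n C 3) ⟩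
  6 * (2+n C 2) + 6 * (2+n C 3)          ≡⟨ cong₂ _+_ (*-assoc 3 2 (2+n C 2)) (6*[2+n]C3≡n*[1+n]*[2+n] n) ⟩
  3 * (2 * (2+n C 2)) + n * (1 + n) * (2 + n)
    ≡⟨ cong (λ a → 3 * a + n * (1 + n) * (2 + n)) (2*[1+n]C2≡n*[1+n] (suc n)) ⟩
  3 * ((1 + n) * (2 + n)) + n * (1 + n) * (2 + n)
    ≡⟨ solve (n ∷ []) ⟩
  (1 + n) * (2 + n) * (3 + n)            ∎
  where
  2+n 3+n : ℕ
  2+n = 2 + n
  3+n = 3 + n

6*TH[m]≡m*[m+1]*[m+2] : ∀ m → 6 * TH m ≡ m * (m + 1) * (m + 2)
6*TH[m]≡m*[m+1]*[m+2] m rewrite +-comm m 2 | +-comm m 1 = 6*[2+n]C3≡n*[1+n]*[2+n] m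

6*q≡m*[m+1]*[m+2]⇒TH[m]≡q : ∀ m q → 6 * q ≡ m * (m + 1) * (m + 2) → TH m ≡ q
6*q≡m*[m+1]*[m+2]⇒TH[m]≡q m q eq = *-cancelˡ-≡ (TH m) q 6 (trans (6*TH[m]≡m*[m+1]*[m+2] m) (sym eq))

Bézout⇒gcd≡1 : ∀ {m n} → Bézout.Identity 1 m n → gcd m n ≡ 1
Bézout⇒gcd≡1 {m} {n} (Bézout.+- x y eq) = ∣1⇒≡1 (d∣1 x y (gcd[m,n]∣m m n) (gcd[m,n]∣n m n) eq)
  where
  d∣1 : ∀ {d a b} x y → d ∣ a → d ∣ b → 1 + y * b ≡ x * a → d ∣ 1
  d∣1 {d} {_} {b} x y d∣a d∣b eq =
    ∣m+n∣m⇒∣n (subst (d ∣_) (trans (sym eq) (+-comm 1 (y * b))) (∣n⇒∣m*n x d∣a)) (∣n⇒∣m*n y d∣b)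
Bézout⇒gcd≡1 {m} {n} (Bézout.-+ x y eq) =
  trans (gcd-comm m n) (Bézout⇒gcd≡1 (Bézout.+- y x eq))

gcd[m,n]≡1⇒gcd[c*m,c*n]≡c : ∀ c {m n} → gcd m n ≡ 1 → gcd (c * m) (c * n) ≡ c
gcd[m,n]≡1⇒gcd[c*m,c*n]≡c c {m} {n} eq = begin
  gcd (c * m) (c * n)  ≡⟨ c*gcd[m,n]≡gcd[cm,cn] c m n ⟨
  c * gcd m n          ≡⟨ cong (c *_) eq ⟩
  c * 1                ≡⟨ *-identityʳ c ⟩
  c                    ∎

gcd[TH[m],TH[m+1]]≡a : ∀ m {a} b c →
                       6 * (a * b) ≡ m * (m + 1) * (m + 2) →
                       6 * (a * c) ≡ (m + 1) * (m + 2) * (m + 3) →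
                       Bézout.Identity 1 b c → gcd (TH m) (TH (m + 1)) ≡ a
gcd[TH[m],TH[m+1]]≡a m {a} b c eqₘ eqₘ₊₁ bézout
  rewrite 6*q≡m*[m+1]*[m+2]⇒TH[m]≡q m (a * b) eqₘ
        | 6*q≡m*[m+1]*[m+2]⇒TH[m]≡q (m + 1) (a * c) (trans eqₘ₊₁ (solve (m ∷ [])))
        = gcd[m,n]≡1⇒gcd[c*m,c*n]≡c a (Bézout⇒gcd≡1 bézout)

lemma9 : (n k : ℕ) → 1 ≤ n →
           (n ≡ 6 * k → gcd (TH n) (TH (n + 1)) ≡ (6 * k + 1) * (3 * k + 1))
         × (n ≡ 6 * k + 1 → gcd (TH n) (TH (n + 1)) ≡ (3 * k + 1) * (2 * k + 1))
         × (n ≡ 6 * k + 2 → gcd (TH n) (TH (n + 1)) ≡ (2 * k + 1) * (3 * k + 2))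
         × (n ≡ 6 * k + 3 → gcd (TH n) (TH (n + 1)) ≡ (3 * k + 2) * (6 * k + 5))
         × (n ≡ 6 * k + 4 → gcd (TH n) (TH (n + 1)) ≡ (6 * k + 5) * (k + 1))
         × (n ≡ 6 * k + 5 → gcd (TH n) (TH (n + 1)) ≡ (k + 1) * (6 * k + 7))
lemma9 n k _ =
    (λ { refl → gcd[TH[m],TH[m+1]]≡a (6 * k) (2 * k) (2 * k + 1) (solve (k ∷ [])) (solve (k ∷ []))
                  (Bézout.-+ 1 1 (solve (k ∷ []))) })
  , (λ { refl → gcd[TH[m],TH[m+1]]≡a (6 * k + 1) (6 * k + 1) (6 * k + 4) (solve (k ∷ [])) (solve (k ∷ []))
                  (Bézout.+- (2 * k + 1) (2 * k) (solve (k ∷ []))) })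
  , (λ { refl → gcd[TH[m],TH[m+1]]≡a (6 * k + 2) (6 * k + 2) (6 * k + 5) (solve (k ∷ [])) (solve (k ∷ []))
                  (Bézout.-+ (2 * k + 2) (2 * k + 1) (solve (k ∷ []))) })
  , (λ { refl → gcd[TH[m],TH[m+1]]≡a (6 * k + 3) (2 * k + 1) (2 * k + 2) (solve (k ∷ [])) (solve (k ∷ []))
                  (Bézout.-+ 1 1 (solve (k ∷ []))) })
  , (λ { refl → gcd[TH[m],TH[m+1]]≡a (6 * k + 4) (6 * k + 4) (6 * k + 7) (solve (k ∷ [])) (solve (k ∷ []))
                  (Bézout.+- (2 * k + 2) (2 * k + 1) (solve (k ∷ []))) })
  , (λ { refl → gcd[TH[m],TH[m+1]]≡a (6 * k + 5) (6 * k + 5) (6 * k + 8) (solve (k ∷ [])) (solve (k ∷ []))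
                  (Bézout.-+ (2 * k + 3) (2 * k + 2) (solve (k ∷ []))) })
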